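{- For every $n\ge 1$, $\mathrm{sat}^*(n,\mathcal B)\ge n+1$; that is, every $\mathcal B$-saturated family of subsets of $[n]$ has at least $n+1$ members.
   Context: Subsets of $[n]=\{1,\dots,n\}$ are ordered by inclusion. For finite posets $\mathcal P$ and $\mathcal Q$, $\mathcal P$ contains an induced copy of $\mathcal Q$ if there is an injective map $f:\mathcal Q\to\mathcal P$ such that for all $a,b\in\mathcal Q$, $a\le b$ if and only if $f(a)\le f(b)$. A family $\mathcal F$ of subsets of $[n]$ is $\mathcal Q$-saturated if $\mathcal F$ contains no induced copy of $\mathcal Q$, but for every $S\subseteq[n]$ with $S\notin\mathcal F$, $\mathcal F\cup\{S\}$ contains an induced copy of $\mathcal Q$. The induced saturation number $\mathrm{sat}^*(n,\mathcal Q)$ is the minimum size of a $\mathcal Q$-saturated family of subsets of $[n]$. The butterfly $\mathcal B$ is the four-element poset $\{a_1,a_2,b_1,b_2\}$ in which $a_1,a_2$ are incomparable, $b_1,b_2$ are incomparable, and $a_i<b_j$ for all $i,j\in\{1,2\}$ (no other relations). -}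

module Defs where

open import Data.Nat using (ℕ)
open import Data.Fin.Subset using (Subset; _⊆_)
open import Data.List using (List; _∷_)
open import Data.List.Membership.Propositional using (_∈_; _∉_)
open import Data.List.Relation.Unary.Unique.Propositional using (Unique)
open import Data.Product using (_×_; ∃-syntax)
open import Relation.Binary.PropositionalEquality using (_≢_)
open import Relation.Nullary using (¬_)

-- Subsets of [n] are `Subset n` (= Vec Bool n), ordered by inclusion `_⊆_`.
-- A family of subsets of [n] is a duplicate-free list of subsets; its size is its length.

-- An induced copy of the butterfly B = {a₁,a₂,b₁,b₂} in a family F:
-- an injective map f : B → F such that x ≤ y in B iff f x ⊆ f y.
IsButterfly : ∀ {n} → Subset n → Subset n → Subset n → Subset n → Set
IsButterfly a₁ a₂ b₁ b₂ =
  (a₁ ≢ a₂) × (a₁ ≢ b₁) × (a₁ ≢ b₂) × (a₂ ≢ b₁) × (a₂ ≢ b₂) × (b₁ ≢ b₂) ×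
  (a₁ ⊆ b₁) × (a₁ ⊆ b₂) × (a₂ ⊆ b₁) × (a₂ ⊆ b₂) ×
  (¬ a₁ ⊆ a₂) × (¬ a₂ ⊆ a₁) × (¬ b₁ ⊆ b₂) × (¬ b₂ ⊆ b₁) ×
  (¬ b₁ ⊆ a₁) × (¬ b₁ ⊆ a₂) × (¬ b₂ ⊆ a₁) × (¬ b₂ ⊆ a₂)

ContainsButterfly : ∀ {n} → List (Subset n) → Set
ContainsButterfly F =
  ∃[ a₁ ] ∃[ a₂ ] ∃[ b₁ ] ∃[ b₂ ]
    (a₁ ∈ F × a₂ ∈ F × b₁ ∈ F × b₂ ∈ F × IsButterfly a₁ a₂ b₁ b₂)

insert : ∀ {n} → Subset n → List (Subset n) → List (Subset n)
insert S F = S ∷ F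

ButterflySaturated : ∀ {n} → List (Subset n) → Set
ButterflySaturated {n} F =
  ¬ ContainsButterfly F ×
  (∀ (S : Subset n) → S ∉ F → ContainsButterfly (insert S F))

-- Adding a set S to a butterfly-free family F can only create butterflies in which S is
-- a bottom or a top. So a saturated F contains ∅, which is comparable with everything.
-- Fix a coordinate i and call X ∈ F climbable if i ∉ X and X ∪ {i} lies below two
-- incomparable members of F. If F had no edge {A, A ∪ {i}} with i ∉ A, adding A ∪ {i}
-- for a climbable A (or for A = ∅) could not make it a top, since F would already contain
-- a butterfly (or ⁅ i ⁆ would be a top); making it a bottom next to another bottom a
-- either yields a climbable a ⊃ A, or A can replace A ∪ {i} to give a butterfly in F.
-- This strictly increasing chain cannot go on forever, so edges exist in every direction.
-- A nonempty family with an edge in every direction has more than n members: removing the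
-- upper end of the edge in direction 0 and forgetting coordinate 0 keeps the other edges.
module Submission where

open import Defs
open import Data.Nat using (ℕ; zero; suc; _≤_; _<_; _+_; z≤n; s≤s)
open import Data.Nat.Properties using (+-comm; module ≤-Reasoning)
import Data.Bool as Bool
open import Data.Fin using (Fin; zero; suc)
import Data.Fin.Properties as Fin
open import Data.Fin.Subset
  using (Subset; _⊆_; _⊈_; _⊂_; _⊃_; _∪_; ⁅_⁆)
  renaming (_∈_ to _∈ₛ_; _∉_ to _∉ₛ_; ⊥ to ∅)
open import Data.Fin.Subset.Properties
  using (_∈?_; _⊆?_; p⊆p∪q; q⊆p∪q; x∈p∪q⁻; x∈⁅x⁆; x∈⁅y⁆⇒x≡y; ∉⊥; ⊥⊆; ⊆-trans; ⊆-reflexive;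
         ∪-identityˡ; ∪-identityʳ)
open import Data.Fin.Subset.Induction using (Acc; acc; ⊃-wellFounded)
open import Data.Vec using (_∷_; tail; there)
open import Data.Vec.Properties using (≡-dec)
open import Data.List using (List; _∷_; length; map; filter)
open import Data.List.Properties using (length-map; filter-notAll)
open import Data.List.Membership.Propositional using (_∈_; _∉_; find; lose)
open import Data.List.Membership.Propositional.Properties using (∈-map⁺; ∈-filter⁺)
import Data.List.Membership.DecPropositional as DecMembership
open import Data.List.Relation.Unary.Unique.Propositional using (Unique)
open import Data.List.Relation.Unary.Any using (here; there)
import Data.List.Relation.Unary.Any as Any
open import Data.Product using (_×_; _,_; proj₁; proj₂; ∃; ∃-syntax)
open import Data.Sum using (_⊎_; inj₁; inj₂)
open import Data.Empty using (⊥-elim)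
open import Function using (_∘_; case_of_)
open import Relation.Nullary using (¬_; Dec; yes; no; ¬?)
open import Relation.Nullary.Decidable using (map′; _×-dec_; decidable-stable)
open import Relation.Binary.PropositionalEquality using (_≡_; _≢_; refl; sym; trans; subst)

private
  variable
    n : ℕ
    i : Fin n
    A a₁ a₂ b b₁ b₂ c₁ c₂ C S : Subset n
    F : List (Subset n)

infix 4 _≟ₛ_ _∈L?_

_≟ₛ_ : (p q : Subset n) → Dec (p ≡ q)
_≟ₛ_ = ≡-dec Bool._≟_

_∈L?_ : (p : Subset n) (F : List (Subset n)) → Dec (p ∈ F)
_∈L?_ = DecMembership._∈?_ _≟ₛ_

⊈⇒≢ : a₁ ⊈ a₂ → a₁ ≢ a₂
⊈⇒≢ a₁⊈a₂ = a₁⊈a₂ ∘ ⊆-reflexive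

⊉⇒≢ : a₂ ⊈ a₁ → a₁ ≢ a₂
⊉⇒≢ a₂⊈a₁ = a₂⊈a₁ ∘ ⊆-reflexive ∘ sym

⊆∧⊉⇒⊂ : a₁ ⊆ a₂ → a₂ ⊈ a₁ → a₁ ⊂ a₂
⊆∧⊉⇒⊂ {a₁ = a₁} {a₂} a₁⊆a₂ a₂⊈a₁ with Fin.any? (λ x → x ∈? a₂ ×-dec ¬? (x ∈? a₁))
... | yes (x , x∈a₂ , x∉a₁) = a₁⊆a₂ , x , x∈a₂ , x∉a₁
... | no ∄x = ⊥-elim (a₂⊈a₁ λ {x} x∈a₂ →
        decidable-stable (x ∈? a₁) (λ x∉a₁ → ∄x (x , x∈a₂ , x∉a₁)))

x∈p∪⁅x⁆ : (p : Subset n) → i ∈ₛ p ∪ ⁅ i ⁆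
x∈p∪⁅x⁆ {i = i} p = q⊆p∪q p ⁅ i ⁆ (x∈⁅x⁆ i)

p⊆q∧x∈q⇒p∪⁅x⁆⊆q : a₁ ⊆ a₂ → i ∈ₛ a₂ → a₁ ∪ ⁅ i ⁆ ⊆ a₂
p⊆q∧x∈q⇒p∪⁅x⁆⊆q {a₁ = a₁} {a₂} {i} a₁⊆a₂ i∈a₂ x∈ with x∈p∪q⁻ a₁ ⁅ i ⁆ x∈
... | inj₁ x∈a₁ = a₁⊆a₂ x∈a₁
... | inj₂ x∈⁅i⁆ = subst (_∈ₛ a₂) (sym (x∈⁅y⁆⇒x≡y i x∈⁅i⁆)) i∈a₂

⊂-Progressive : (Subset n → Set) → Set
⊂-Progressive P = ∀ {A} → P A → ∃[ X ] (A ⊂ X × P X)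

⊂-progressive⇒empty : {P : Subset n → Set} → ⊂-Progressive P → ∀ A → ¬ P A
⊂-progressive⇒empty {P = P} progress A = climb (⊃-wellFounded A)
  where
  climb : ∀ {A} → Acc _⊃_ A → ¬ P A
  climb (acc larger) pA = let X , A⊂X , pX = progress pA in climb (larger A⊂X) pX

-- IsButterfly without its redundant components: distinctness, and b ⊈ a (which would
-- give b₁ ⊆ a ⊆ b₂), follow from these eight.
record Butterfly (a₁ a₂ b₁ b₂ : Subset n) : Set where
  field
    a₁⊆b₁ : a₁ ⊆ b₁
    a₁⊆b₂ : a₁ ⊆ b₂
    a₂⊆b₁ : a₂ ⊆ b₁
    a₂⊆b₂ : a₂ ⊆ b₂
    a₁⊈a₂ : a₁ ⊈ a₂
    a₂⊈a₁ : a₂ ⊈ a₁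
    b₁⊈b₂ : b₁ ⊈ b₂
    b₂⊈b₁ : b₂ ⊈ b₁

  b₁⊈a₁ : b₁ ⊈ a₁
  b₁⊈a₁ b₁⊆a₁ = b₁⊈b₂ (⊆-trans b₁⊆a₁ a₁⊆b₂)

  b₁⊈a₂ : b₁ ⊈ a₂
  b₁⊈a₂ b₁⊆a₂ = b₁⊈b₂ (⊆-trans b₁⊆a₂ a₂⊆b₂)

  b₂⊈a₁ : b₂ ⊈ a₁
  b₂⊈a₁ b₂⊆a₁ = b₂⊈b₁ (⊆-trans b₂⊆a₁ a₁⊆b₁)

  b₂⊈a₂ : b₂ ⊈ a₂
  b₂⊈a₂ b₂⊆a₂ = b₂⊈b₁ (⊆-trans b₂⊆a₂ a₂⊆b₁)

IsButterfly⇒Butterfly : IsButterfly a₁ a₂ b₁ b₂ → Butterfly a₁ a₂ b₁ b₂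
IsButterfly⇒Butterfly (_ , _ , _ , _ , _ , _ , r₁₁ , r₁₂ , r₂₁ , r₂₂ , n₁₂ , n₂₁ , m₁₂ , m₂₁ , _) =
  record { a₁⊆b₁ = r₁₁ ; a₁⊆b₂ = r₁₂ ; a₂⊆b₁ = r₂₁ ; a₂⊆b₂ = r₂₂
         ; a₁⊈a₂ = n₁₂ ; a₂⊈a₁ = n₂₁ ; b₁⊈b₂ = m₁₂ ; b₂⊈b₁ = m₂₁ }

Butterfly⇒IsButterfly : Butterfly a₁ a₂ b₁ b₂ → IsButterfly a₁ a₂ b₁ b₂
Butterfly⇒IsButterfly B =
  ⊈⇒≢ a₁⊈a₂ , ⊉⇒≢ b₁⊈a₁ , ⊉⇒≢ b₂⊈a₁ , ⊉⇒≢ b₁⊈a₂ , ⊉⇒≢ b₂⊈a₂ , ⊈⇒≢ b₁⊈b₂ ,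
  a₁⊆b₁ , a₁⊆b₂ , a₂⊆b₁ , a₂⊆b₂ , a₁⊈a₂ , a₂⊈a₁ , b₁⊈b₂ , b₂⊈b₁ ,
  b₁⊈a₁ , b₁⊈a₂ , b₂⊈a₁ , b₂⊈a₂
  where open Butterfly B

swap-bottoms : Butterfly a₁ a₂ b₁ b₂ → Butterfly a₂ a₁ b₁ b₂
swap-bottoms B = record
  { a₁⊆b₁ = a₂⊆b₁ ; a₁⊆b₂ = a₂⊆b₂ ; a₂⊆b₁ = a₁⊆b₁ ; a₂⊆b₂ = a₁⊆b₂
  ; a₁⊈a₂ = a₂⊈a₁ ; a₂⊈a₁ = a₁⊈a₂ ; b₁⊈b₂ = b₁⊈b₂ ; b₂⊈b₁ = b₂⊈b₁ }
  where open Butterfly B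

swap-tops : Butterfly a₁ a₂ b₁ b₂ → Butterfly a₁ a₂ b₂ b₁
swap-tops B = record
  { a₁⊆b₁ = a₁⊆b₂ ; a₁⊆b₂ = a₁⊆b₁ ; a₂⊆b₁ = a₂⊆b₂ ; a₂⊆b₂ = a₂⊆b₁
  ; a₁⊈a₂ = a₁⊈a₂ ; a₂⊈a₁ = a₂⊈a₁ ; b₁⊈b₂ = b₂⊈b₁ ; b₂⊈b₁ = b₁⊈b₂ }
  where open Butterfly B

shrink-bottom : Butterfly a₁ a₂ b₁ b₂ → A ⊆ a₁ → A ⊈ a₂ → Butterfly A a₂ b₁ b₂
shrink-bottom B A⊆a₁ A⊈a₂ = record
  { a₁⊆b₁ = ⊆-trans A⊆a₁ a₁⊆b₁ ; a₁⊆b₂ = ⊆-trans A⊆a₁ a₁⊆b₂ ; a₂⊆b₁ = a₂⊆b₁ ; a₂⊆b₂ = a₂⊆b₂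
  ; a₁⊈a₂ = A⊈a₂ ; a₂⊈a₁ = λ a₂⊆A → a₂⊈a₁ (⊆-trans a₂⊆A A⊆a₁)
  ; b₁⊈b₂ = b₁⊈b₂ ; b₂⊈b₁ = b₂⊈b₁ }
  where open Butterfly B

raise-tops : Butterfly a₁ a₂ b b₂ → b ⊆ c₁ → b ⊆ c₂ → c₁ ⊈ c₂ → c₂ ⊈ c₁ → Butterfly a₁ a₂ c₁ c₂
raise-tops B b⊆c₁ b⊆c₂ c₁⊈c₂ c₂⊈c₁ = record
  { a₁⊆b₁ = ⊆-trans a₁⊆b₁ b⊆c₁ ; a₁⊆b₂ = ⊆-trans a₁⊆b₁ b⊆c₂
  ; a₂⊆b₁ = ⊆-trans a₂⊆b₁ b⊆c₁ ; a₂⊆b₂ = ⊆-trans a₂⊆b₁ b⊆c₂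
  ; a₁⊈a₂ = a₁⊈a₂ ; a₂⊈a₁ = a₂⊈a₁ ; b₁⊈b₂ = c₁⊈c₂ ; b₂⊈b₁ = c₂⊈c₁ }
  where open Butterfly B

∅-not-bottom : ¬ Butterfly ∅ a₂ b₁ b₂
∅-not-bottom B = Butterfly.a₁⊈a₂ B ⊥⊆

∅-not-top : ¬ Butterfly a₁ a₂ ∅ b₂
∅-not-top B = a₁⊈a₂ (⊆-trans a₁⊆b₁ ⊥⊆)
  where open Butterfly B

-- A member of a₁ would be i, making the top ⁅ i ⁆ a subset of a₁; so a₁ = ∅ ⊆ a₂.
⁅⁆-not-top : ¬ Butterfly a₁ a₂ ⁅ i ⁆ b₂
⁅⁆-not-top {a₁ = a₁} {i = i} B = a₁⊈a₂ λ x∈a₁ → ⊥-elim (b₁⊈a₁ (⁅i⁆⊆a₁ x∈a₁))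
  where
  open Butterfly B
  ⁅i⁆⊆a₁ : ∀ {x} → x ∈ₛ a₁ → ⁅ i ⁆ ⊆ a₁
  ⁅i⁆⊆a₁ x∈a₁ y∈⁅i⁆ =
    subst (_∈ₛ a₁) (trans (x∈⁅y⁆⇒x≡y i (a₁⊆b₁ x∈a₁)) (sym (x∈⁅y⁆⇒x≡y i y∈⁅i⁆))) x∈a₁

ButterflyBottom : List (Subset n) → Subset n → Set
ButterflyBottom F S = ∃[ a ] ∃[ b₁ ] ∃[ b₂ ] (a ∈ F × b₁ ∈ F × b₂ ∈ F × Butterfly S a b₁ b₂)

ButterflyTop : List (Subset n) → Subset n → Set
ButterflyTop F S = ∃[ a₁ ] ∃[ a₂ ] ∃[ b ] (a₁ ∈ F × a₂ ∈ F × b ∈ F × Butterfly a₁ a₂ S b)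

BelowIncomparablePair : List (Subset n) → Subset n → Set
BelowIncomparablePair F C =
  ∃[ c₁ ] ∃[ c₂ ] (c₁ ∈ F × c₂ ∈ F × C ⊆ c₁ × C ⊆ c₂ × c₁ ⊈ c₂ × c₂ ⊈ c₁)

∈-∷-≢⇒∈ : ∀ {X : Set} {x y : X} {xs : List X} → x ∈ y ∷ xs → x ≢ y → x ∈ xs
∈-∷-≢⇒∈ (here x≡y) x≢y = ⊥-elim (x≢y x≡y)
∈-∷-≢⇒∈ (there x∈xs) _ = x∈xs

module _ (free : ¬ ContainsButterfly F) where

  butterfly-in-insert⁻ : a₁ ∈ S ∷ F → a₂ ∈ S ∷ F → b₁ ∈ S ∷ F → b₂ ∈ S ∷ F →
    Butterfly a₁ a₂ b₁ b₂ → ButterflyBottom F S ⊎ ButterflyTop F S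
  butterfly-in-insert⁻ (here refl) m₂ m₃ m₄ B =
    inj₁ (_ , _ , _ , ∈-∷-≢⇒∈ m₂ (⊉⇒≢ a₁⊈a₂) , ∈-∷-≢⇒∈ m₃ (⊈⇒≢ b₁⊈a₁) , ∈-∷-≢⇒∈ m₄ (⊈⇒≢ b₂⊈a₁) , B)
    where open Butterfly B
  butterfly-in-insert⁻ (there m₁) (here refl) m₃ m₄ B =
    inj₁ (_ , _ , _ , m₁ , ∈-∷-≢⇒∈ m₃ (⊈⇒≢ b₁⊈a₂) , ∈-∷-≢⇒∈ m₄ (⊈⇒≢ b₂⊈a₂) , swap-bottoms B)
    where open Butterfly B
  butterfly-in-insert⁻ (there m₁) (there m₂) (here refl) m₄ B =
    inj₂ (_ , _ , _ , m₁ , m₂ , ∈-∷-≢⇒∈ m₄ (⊉⇒≢ b₁⊈b₂) , B)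
    where open Butterfly B
  butterfly-in-insert⁻ (there m₁) (there m₂) (there m₃) (here refl) B =
    inj₂ (_ , _ , _ , m₁ , m₂ , m₃ , swap-tops B)
  butterfly-in-insert⁻ (there m₁) (there m₂) (there m₃) (there m₄) B =
    ⊥-elim (free (_ , _ , _ , _ , m₁ , m₂ , m₃ , m₄ , Butterfly⇒IsButterfly B))

  ContainsButterfly-insert⁻ : ContainsButterfly (S ∷ F) → ButterflyBottom F S ⊎ ButterflyTop F S
  ContainsButterfly-insert⁻ (_ , _ , _ , _ , m₁ , m₂ , m₃ , m₄ , B) =
    butterfly-in-insert⁻ m₁ m₂ m₃ m₄ (IsButterfly⇒Butterfly B)

  below-pair⇒not-top : BelowIncomparablePair F C → ¬ ButterflyTop F C
  below-pair⇒not-top (c₁ , c₂ , c₁∈F , c₂∈F , C⊆c₁ , C⊆c₂ , c₁⊈c₂ , c₂⊈c₁)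
                     (a₁ , a₂ , _ , a₁∈F , a₂∈F , _ , B) =
    free (a₁ , a₂ , c₁ , c₂ , a₁∈F , a₂∈F , c₁∈F , c₂∈F ,
          Butterfly⇒IsButterfly (raise-tops B C⊆c₁ C⊆c₂ c₁⊈c₂ c₂⊈c₁))

Edge : Fin n → List (Subset n) → Set
Edge i F = ∃[ A ] (A ∈ F × i ∉ₛ A × A ∪ ⁅ i ⁆ ∈ F)

edge? : (i : Fin n) (F : List (Subset n)) → Dec (Edge i F)
edge? i F = map′ find (λ (_ , A∈F , edge) → lose A∈F edge)
  (Any.any? (λ A → ¬? (i ∈? A) ×-dec (A ∪ ⁅ i ⁆ ∈L? F)) F)

module Saturated {n} {F : List (Subset n)} (saturated : ButterflySaturated F) where

  private
    free : ¬ ContainsButterfly F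
    free = proj₁ saturated

    newcomer : S ∉ F → ButterflyBottom F S ⊎ ButterflyTop F S
    newcomer {S = S} S∉F = ContainsButterfly-insert⁻ free (proj₂ saturated S S∉F)

  ∅∈F : ∅ ∈ F
  ∅∈F = decidable-stable (∅ ∈L? F) λ ∅∉F → case newcomer ∅∉F of λ where
    (inj₁ (_ , _ , _ , _ , _ , _ , B)) → ∅-not-bottom B
    (inj₂ (_ , _ , _ , _ , _ , _ , B)) → ∅-not-top B

  module _ (i : Fin n) where

    Climbable : Subset n → Set
    Climbable X = X ∈ F × i ∉ₛ X × BelowIncomparablePair F (X ∪ ⁅ i ⁆)

    bottom⇒climbable : ButterflyBottom F (A ∪ ⁅ i ⁆) → A ∈ F → ∃[ X ] (A ⊂ X × Climbable X)
    bottom⇒climbable {A = A} (a , b₁ , b₂ , a∈F , b₁∈F , b₂∈F , B) A∈F with A ⊆? a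
    ... | no A⊈a = ⊥-elim (free (A , a , b₁ , b₂ , A∈F , a∈F , b₁∈F , b₂∈F ,
                    Butterfly⇒IsButterfly (shrink-bottom B (p⊆p∪q ⁅ i ⁆) A⊈a)))
    ... | yes A⊆a = a , A⊂a , a∈F , i∉a ,
                    (b₁ , b₂ , b₁∈F , b₂∈F , lift a₂⊆b₁ a₁⊆b₁ , lift a₂⊆b₂ a₁⊆b₂ , b₁⊈b₂ , b₂⊈b₁)
      where
      open Butterfly B
      A⊂a : A ⊂ a
      A⊂a = ⊆∧⊉⇒⊂ A⊆a (λ a⊆A → a₂⊈a₁ (⊆-trans a⊆A (p⊆p∪q ⁅ i ⁆)))
      i∉a : i ∉ₛ a
      i∉a i∈a = a₁⊈a₂ (p⊆q∧x∈q⇒p∪⁅x⁆⊆q A⊆a i∈a)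
      lift : a ⊆ b → A ∪ ⁅ i ⁆ ⊆ b → a ∪ ⁅ i ⁆ ⊆ b
      lift a⊆b A⁺⊆b = p⊆q∧x∈q⇒p∪⁅x⁆⊆q a⊆b (A⁺⊆b (x∈p∪⁅x⁆ A))

    module _ (noEdge : ¬ Edge i F) where

      private
        newcomer⁺ : A ∈ F → i ∉ₛ A → ButterflyBottom F (A ∪ ⁅ i ⁆) ⊎ ButterflyTop F (A ∪ ⁅ i ⁆)
        newcomer⁺ A∈F i∉A = newcomer λ A⁺∈F → noEdge (_ , A∈F , i∉A , A⁺∈F)

      climbable-progressive : ⊂-Progressive Climbable
      climbable-progressive (A∈F , i∉A , below) with newcomer⁺ A∈F i∉A
      ... | inj₁ bottom = bottom⇒climbable bottom A∈F
      ... | inj₂ top = ⊥-elim (below-pair⇒not-top free below top)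

      climbable-exists : ∃ Climbable
      climbable-exists with newcomer⁺ ∅∈F ∉⊥
      ... | inj₁ bottom = let X , _ , climbable = bottom⇒climbable bottom ∅∈F in X , climbable
      ... | inj₂ (_ , _ , _ , _ , _ , _ , B) =
            ⊥-elim (⁅⁆-not-top (subst (λ T → Butterfly _ _ T _) (∪-identityˡ ⁅ i ⁆) B))

    edge : Edge i F
    edge = decidable-stable (edge? i F) λ noEdge →
      let X , climbable = climbable-exists noEdge in
      ⊂-progressive⇒empty (climbable-progressive noEdge) X climbable

tail-∪⁅zero⁆ : (A : Subset (suc n)) → tail (A ∪ ⁅ zero ⁆) ≡ tail A
tail-∪⁅zero⁆ (_ ∷ A) = ∪-identityʳ A

edge-tail : {F : List (Subset (suc n))} {G : List (Subset n)} {j : Fin n} →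
  (∀ {z} → z ∈ F → tail z ∈ G) → Edge (suc j) F → Edge j G
edge-tail tail∈G (_ ∷ B , B∈F , sj∉B , B⁺∈F) = B , tail∈G B∈F , sj∉B ∘ there , tail∈G B⁺∈F

edges⇒n<length : ∀ {n} {F : List (Subset n)} {x} → x ∈ F → (∀ i → Edge i F) → n < length F
edges⇒n<length {zero} (here _) _ = s≤s z≤n
edges⇒n<length {zero} (there _) _ = s≤s z≤n
edges⇒n<length {suc n} {F} x∈F edges with edges zero
... | A , A∈F , 0∉A , A⁺∈F = begin-strict
  suc n                 ≤⟨ edges⇒n<length (tail∈G x∈F) (λ j → edge-tail tail∈G (edges (suc j))) ⟩
  length (map tail F′)  ≡⟨ length-map tail F′ ⟩
  length F′             <⟨ filter-notAll ≢A⁺? F (lose A⁺∈F λ A⁺≢A⁺ → A⁺≢A⁺ refl) ⟩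
  length F              ∎
  where
  open ≤-Reasoning
  A⁺ : Subset (suc n)
  A⁺ = A ∪ ⁅ zero ⁆
  ≢A⁺? : (z : Subset (suc n)) → Dec (z ≢ A⁺)
  ≢A⁺? z = ¬? (z ≟ₛ A⁺)
  F′ : List (Subset (suc n))
  F′ = filter ≢A⁺? F
  A≢A⁺ : A ≢ A⁺
  A≢A⁺ A≡A⁺ = 0∉A (subst (zero ∈ₛ_) (sym A≡A⁺) (x∈p∪⁅x⁆ A))
  tail∈G : ∀ {z} → z ∈ F → tail z ∈ map tail F′
  tail∈G {z} z∈F with z ≟ₛ A⁺
  ... | no z≢A⁺ = ∈-map⁺ tail (∈-filter⁺ ≢A⁺? z∈F z≢A⁺)
  ... | yes refl = subst (_∈ map tail F′) (sym (tail-∪⁅zero⁆ A)) (∈-map⁺ tail (∈-filter⁺ ≢A⁺? A∈F A≢A⁺))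

theorem2 : (n : ℕ) → 1 ≤ n → (F : List (Subset n)) → Unique F →
    ButterflySaturated F → n + 1 ≤ length F
theorem2 n _ F _ saturated =
  subst (_≤ length F) (+-comm 1 n) (edges⇒n<length ∅∈F edge)
  where open Saturated saturated
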